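{- A function $F\colon\{0,1\}^{\mathbb{N}}\to\mathbb{N}$ is uniformly continuous, i.e. $(\exists n\in\mathbb{N})(\forall\alpha,\beta\in\{0,1\}^{\mathbb{N}})[\overline{\alpha}n=\overline{\beta}n\to F(\alpha)=F(\beta)]$, if and only if $F$ is $K_C$-realisable.
   Context: Work in Bishop-style constructive mathematics (no excluded middle; countable choice and unique choice available). $\{0,1\}^*$ denotes finite binary sequences, $a*b$ concatenation, $\langle\rangle$ the empty sequence, $\langle i\rangle$ a one-element sequence, $\overline{\alpha}n$ the initial segment of length $n$ of $\alpha$. The class $K_C$ of Brouwer-operations on Cantor space is the predicate on functions $\gamma\colon\{0,1\}^*\to\mathbb{N}$ inductively defined (i.e. the least class, with the corresponding induction principle) by: (i) for each $n\in\mathbb{N}$, the constant function $\lambda a.\,n+1\in K_C$; (ii) if $\gamma(\langle\rangle)=0$ and for each $i\in\{0,1\}$, $\lambda a.\,\gamma(\langle i\rangle*a)\in K_C$, then $\gamma\in K_C$. Each $\gamma\in K_C$ determines $F_\gamma\colon\{0,1\}^{\mathbb{N}}\to\mathbb{N}$ by $F_\gamma(\alpha)=\gamma(\overline{\alpha}m)-1$ where $m$ is the least $z$ with $\gamma(\overline{\alpha}z)>0$. A function $F$ is $K_C$-realisable if $F=F_\gamma$ for some $\gamma\in K_C$. -}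

module Defs where

open import Data.Nat using (ℕ; zero; suc; _<_; _∸_)
open import Data.Bool using (Bool)
open import Data.List using (List; []; _∷_)
open import Data.Product using (Σ; _×_)
open import Relation.Binary.PropositionalEquality using (_≡_)

Cantor : Set
Cantor = ℕ → Bool

Seq : Set
Seq = List Bool

init : Cantor → ℕ → Seq
init α zero    = []
init α (suc n) = α 0 ∷ init (λ k → α (suc k)) n

-- The inductively defined class K_C of Brouwer-operations on Cantor space.
-- (i)  constant function λa. n+1  (given pointwise, as functions are compared extensionally)
-- (ii) γ⟨⟩ = 0 and for each i ∈ {0,1}, λa. γ(⟨i⟩ * a) ∈ K_C   ⟹  γ ∈ K_C
data KC : (Seq → ℕ) → Set where
  kc-const  : (γ : Seq → ℕ) (n : ℕ) → (∀ a → γ a ≡ suc n) → KC γ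
  kc-branch : (γ : Seq → ℕ) → γ [] ≡ 0 → ((i : Bool) → KC (λ a → γ (i ∷ a))) → KC γ

-- F_γ(α) = γ(ᾱm) ∸ 1, where m is the least z with γ(ᾱz) > 0.
-- "F α equals F_γ α" unfolded: there is such a least m, and F α = γ(ᾱm) - 1.
IsFγValue : (Seq → ℕ) → Cantor → ℕ → Set
IsFγValue γ α v =
  Σ ℕ (λ m → ((z : ℕ) → z < m → γ (init α z) ≡ 0)
            × (0 < γ (init α m))
            × (v ≡ γ (init α m) ∸ 1))

KCRealisable : (Cantor → ℕ) → Set
KCRealisable F = Σ (Seq → ℕ) (λ γ → KC γ × ((α : Cantor) → IsFγValue γ α (F α)))

UniformlyContinuous : (Cantor → ℕ) → Set
UniformlyContinuous F =
  Σ ℕ (λ n → (α β : Cantor) → init α n ≡ init β n → F α ≡ F β)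

-- (⇒) If n is a modulus of uniform continuity of F, then F(α) depends only
--     on ᾱn.  The "tabulation" of F to depth n is the Brouwer-operation that
--     answers 0 on sequences shorter than n and F(a * 000…) + 1 on sequences a
--     of length n; it lies in K_C by an n-fold use of the branching rule and
--     realises F, since its first positive value along α is at ᾱn.
-- (⇐) Every γ ∈ K_C has a depth: 0 for a constant tree, one more than the
--     larger depth of its two subtrees for a branching tree.  By induction on
--     K_C, the value F_γ(α) is determined by the initial segment of α of that
--     depth; the key step is that at a branching node a value of F_γ at α is a
--     value of the subtree ⟨α0⟩ at the tail of α.  Hence the depth of a
--     realiser of F is a modulus of uniform continuity of F.
module Submission where

open import Defs
open import Data.Nat using (ℕ; zero; suc; _<_; _≤_; _∸_; z≤n; s≤s; _⊔_)
open import Data.Nat.Properties using (m≤m⊔n; m≤n⊔m)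
open import Data.Bool using (Bool; true; false)
open import Data.List using ([]; _∷_)
open import Data.List.Properties using (∷-injectiveˡ; ∷-injectiveʳ)
open import Data.Product using (_,_)
open import Relation.Binary.PropositionalEquality using (_≡_; refl; sym; trans; cong; cong₂; subst; module ≡-Reasoning)
open import Function.Bundles using (_⇔_; mk⇔)

cons : Bool → Cantor → Cantor
cons i β zero    = i
cons i β (suc k) = β k

tail : Cantor → Cantor
tail α k = α (suc k)

init-≤ : ∀ {n N} (α β : Cantor) → n ≤ N → init α N ≡ init β N → init α n ≡ init β n
init-≤ α β z≤n       _ = refl
init-≤ α β (s≤s n≤N) e =
  cong₂ _∷_ (∷-injectiveˡ e) (init-≤ (tail α) (tail β) n≤N (∷-injectiveʳ e))

Modulus : (Cantor → ℕ) → ℕ → Set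
Modulus G n = (α β : Cantor) → init α n ≡ init β n → G α ≡ G β

modulus-section : ∀ {G n} (i : Bool) → Modulus G (suc n) → Modulus (λ β → G (cons i β)) n
modulus-section i uc β β' e = uc (cons i β) (cons i β') (cong (i ∷_) e)

zeros : Cantor
zeros _ = false

tabulate : ℕ → (Cantor → ℕ) → Seq → ℕ
tabulate zero    G a       = suc (G zeros)
tabulate (suc n) G []      = 0
tabulate (suc n) G (i ∷ a) = tabulate n (λ β → G (cons i β)) a

tabulate-KC : ∀ n G → KC (tabulate n G)
tabulate-KC zero    G = kc-const _ (G zeros) (λ _ → refl)
tabulate-KC (suc n) G = kc-branch _ refl (λ i → tabulate-KC n (λ β → G (cons i β)))

-- The tabulation to depth n of a function with modulus n realises it; the
-- least position with a positive value is exactly n.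
tabulate-realises : ∀ n G → Modulus G n → (α : Cantor) → IsFγValue (tabulate n G) α (G α)
tabulate-realises zero G uc α = 0 , (λ _ ()) , s≤s z≤n , uc α zeros refl
tabulate-realises (suc n) G uc α
  with tabulate-realises n (λ β → G (cons (α 0) β)) (modulus-section (α 0) uc) (tail α)
... | m , below , pos , value = suc m , zeroBelow , pos , trans (uc α (cons (α 0) (tail α)) refl) value
  where
  zeroBelow : (z : ℕ) → z < suc m → tabulate (suc n) G (init α z) ≡ 0
  zeroBelow zero    _         = refl
  zeroBelow (suc z) (s≤s z<m) = below z z<m

depth : ∀ {γ} → KC γ → ℕ
depth (kc-const _ _ _)    = 0
depth (kc-branch _ _ sub) = suc (depth (sub true) ⊔ depth (sub false))

≤-max-Bool : (d : Bool → ℕ) (i : Bool) → d i ≤ d true ⊔ d false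
≤-max-Bool d true  = m≤m⊔n _ _
≤-max-Bool d false = m≤n⊔m _ _

-- At a node where γ⟨⟩ = 0, a value of F_γ at α is a value of the subtree
-- ⟨α0⟩ at the tail of α (the least positive position cannot be 0).
value-tail : ∀ γ → γ [] ≡ 0 → ∀ α v →
             IsFγValue γ α v → IsFγValue (λ a → γ (α 0 ∷ a)) (tail α) v
value-tail γ γ⟨⟩≡0 α v (zero , _ , pos , _) with subst (0 <_) γ⟨⟩≡0 pos
... | ()
value-tail γ γ⟨⟩≡0 α v (suc m , below , pos , value) =
  m , (λ z z<m → below (suc z) (s≤s z<m)) , pos , value

Determined : (Seq → ℕ) → ℕ → Set
Determined γ n = (α β : Cantor) → init α n ≡ init β n →
                 ∀ {v w} → IsFγValue γ α v → IsFγValue γ β w → v ≡ w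

constant-value : ∀ {γ n α v} → (∀ a → γ a ≡ suc n) → IsFγValue γ α v → v ≡ n
constant-value {γ} {n} {α} {v} const (m , _ , _ , v≡) = begin
  v                  ≡⟨ v≡ ⟩
  γ (init α m) ∸ 1   ≡⟨ cong (_∸ 1) (const (init α m)) ⟩
  n                  ∎
  where open ≡-Reasoning

-- Every γ ∈ K_C is determined by initial segments of its depth.  At a branching
-- node both values descend to the same subtree ⟨α0⟩ = ⟨β0⟩, whose depth is at
-- most the depth of γ minus one.
determined-by-depth : ∀ {γ} (k : KC γ) → Determined γ (depth k)
determined-by-depth (kc-const γ n const) α β _ pv pw =
  trans (constant-value const pv) (sym (constant-value const pw))
determined-by-depth (kc-branch γ γ⟨⟩≡0 sub) α β e {v} {w} pv pw =
  determined-by-depth (sub (α 0)) (tail α) (tail β)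
    (init-≤ (tail α) (tail β) (≤-max-Bool (λ i → depth (sub i)) (α 0)) (∷-injectiveʳ e))
    (value-tail γ γ⟨⟩≡0 α v pv)
    (subst (λ i → IsFγValue (λ a → γ (i ∷ a)) (tail β) w) (sym (∷-injectiveˡ e))
           (value-tail γ γ⟨⟩≡0 β w pw))

proposition3p2 : (F : Cantor → ℕ) → UniformlyContinuous F ⇔ KCRealisable F
proposition3p2 F = mk⇔ realise continuous
  where
  realise : UniformlyContinuous F → KCRealisable F
  realise (n , uc) = tabulate n F , tabulate-KC n F , tabulate-realises n F uc

  continuous : KCRealisable F → UniformlyContinuous F
  continuous (γ , k , realises) =
    depth k , λ α β e → determined-by-depth k α β e (realises α) (realises β)
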